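{- Let $G=(A,R,C)$ be an abstract dialectical framework and let $F=(A,R,f_Q)\in\Delta[G]$ be such that there is no $F'\in\Delta[G]$ with $F'\sqsubset F$. If $\mathrm{Exact}_{\mathrm{one}}(F)\neq\emptyset$, then $\mathrm{Exact}(G)\neq\emptyset$.
   Context: Labels: $\mathcal{L}=\{\mathsf{in},\mathsf{out},\mathsf{undec}\}$. For a finite set $S$ of arguments, $\Lambda^S$ is the set of total functions $S\to\mathcal{L}$. A nuance tuple is $((n_1,n_2),(m_1,m_2))\in\mathbb{N}^4$ with $n_1\le n_2$, $m_1\le m_2$. A may-must argumentation (MMA) is $(A,R,f_Q)$ with $A$ finite, $R\subseteq A\times A$, $f_Q$ assigning a nuance tuple to each argument. $\mathrm{pre}(a)=\{b\in A:(b,a)\in R\}$. For $\lambda$ a labelling, $o_\lambda(a)$ (resp. $i_\lambda(a)$) is the number of $b\in\mathrm{pre}(a)$ with $\lambda(b)=\mathsf{out}$ (resp. $\mathsf{in}$). With $f_Q(a)=((n_1,n_2),(m_1,m_2))$: may-a iff $n_1\le o_\lambda(a)$; must-a iff $n_2\le o_\lambda(a)$; may$_s$-a iff $n_1\le o_\lambda(a)<n_2$; not-a iff $o_\lambda(a)<n_1$; may-r, must-r, may$_s$-r, not-r likewise with $m_1,m_2,i_\lambda(a)$. $\lambda$ designates $l$ for $a$ in the MMA iff $\lambda$ is defined on all of $\mathrm{pre}(a)$ and: $l=\mathsf{in}$ requires may-a and not must-r; $l=\mathsf{out}$ requires may-r and not must-a; $l=\mathsf{undec}$ requires (must-a and must-r)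 or may$_s$-a or may$_s$-r or (not-a and not-r). An abstract dialectical framework (ADF) is $(A,R,C)$ with $C=(C_a)_{a\in A}$, $C_a:\Lambda^{\mathrm{pre}(a)}\to\mathcal{L}$; $\lambda$ designates $l$ for $a$ in the ADF iff $\lambda$ is defined on $\mathrm{pre}(a)$ and $C_a(\lambda|_{\mathrm{pre}(a)})=l$. $\lambda\in\Lambda^A$ is an exact labelling (of an MMA or ADF) iff for every $a\in A$, $\lambda$ designates $\lambda(a)$ for $a$. $\mathrm{Exact}(\cdot)$ is the set of exact labellings; $\mathrm{Exact}_{\mathrm{one}}(F)$ is the set of exact labellings $\lambda$ of the MMA $F$ such that for every $a\in A$, $\lambda$ designates at most one label for $a$ in $F$. $\Delta[G]$ (abstractions of ADF $G=(A,R,C)$): all MMAs $(A,R,f_Q)$ such that for every $a$, with $f_Q(a)=((n_1,n_2),(m_1,m_2))$, $n_2,m_2\le|\mathrm{pre}(a)|+1$, and for every $\lambda\in\Lambda^{\mathrm{pre}(a)}$, with $o=o_\lambda(a),i=i_\lambda(a)$: $o<n_1,i<m_1\Rightarrow C_a(\lambda)=\mathsf{undec}$; $n_1\le o<n_2,i<m_1\Rightarrow C_a(\lambda)\in\{\mathsf{in},\mathsf{undec}\}$; $n_2\le o,i<m_1\Rightarrow\mathsf{in}$; $o<n_1,m_1\le i<m_2\Rightarrow\{\mathsf{out},\mathsf{undec}\}$; $n_1\le o<n_2,m_1\le i<m_2\Rightarrow$ arbitrary; $n_2\le o,m_1\le i<m_2\Rightarrow\{\mathsf{in},\mathsf{undec}\}$;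 $o<n_1,m_2\le i\Rightarrow\mathsf{out}$; $n_1\le o<n_2,m_2\le i\Rightarrow\{\mathsf{out},\mathsf{undec}\}$; $n_2\le o,m_2\le i\Rightarrow\mathsf{undec}$. Order: $((n_1,n_2),(m_1,m_2))\unlhd((n_1',n_2'),(m_1',m_2'))$ iff $n_1'\le n_1$, $n_2\le n_2'$, $m_1'\le m_1$, $m_2\le m_2'$; $(A,R,f_Q)\sqsubseteq(A,R,f'_Q)$ iff $f_Q(a)\unlhd f'_Q(a)$ for all $a$; $F'\sqsubset F$ iff $F'\sqsubseteq F$ and not $F\sqsubseteq F'$. -}

module Defs where

open import Data.Nat using (ℕ; zero; suc; _≤_; _<_)
open import Data.Bool using (Bool; true; false; T)
open import Data.Fin using (Fin; zero; suc)
open import Data.Unit using (tt)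
open import Data.Product using (_×_; Σ; ∃; _,_)
open import Data.Sum using (_⊎_)
open import Data.Empty using (⊥)
open import Relation.Nullary using (¬_)
open import Relation.Binary.PropositionalEquality using (_≡_)

data Label : Set where
  lin lout lundec : Label

isOut : Label → Bool
isOut lout = true
isOut _    = false

isIn : Label → Bool
isIn lin = true
isIn _   = false

count : ∀ {k} → (Fin k → Bool) → ℕ
count {zero}  p = 0
count {suc k} p with p zero
... | true  = suc (count (λ i → p (suc i)))
... | false = count (λ i → p (suc i))

-- Arguments are Fin k; the attack relation R is decidable: (b , a) ∈ R iff R b a ≡ true.
Rel : ℕ → Set
Rel k = Fin k → Fin k → Bool

-- Λ^{pre(a)}: labellings defined exactly on the attackers of a
PreLab : ∀ {k} → Rel k → Fin k → Set
PreLab {k} R a = (b : Fin k) → T (R b a) → Label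

Labelling : ℕ → Set
Labelling k = Fin k → Label

restrict : ∀ {k} (R : Rel k) (a : Fin k) → Labelling k → PreLab R a
restrict R a λ' b _ = λ' b

private
  testAt : (Label → Bool) → (r : Bool) → (T r → Label) → Bool
  testAt t true  μ = t (μ tt)
  testAt t false μ = false

oPre : ∀ {k} (R : Rel k) (a : Fin k) → PreLab R a → ℕ
oPre R a μ = count (λ b → testAt isOut (R b a) (μ b))

iPre : ∀ {k} (R : Rel k) (a : Fin k) → PreLab R a → ℕ
iPre R a μ = count (λ b → testAt isIn (R b a) (μ b))

preSize : ∀ {k} (R : Rel k) (a : Fin k) → ℕ
preSize R a = count (λ b → R b a)

record ADF (k : ℕ) : Set where
  field
    R : Rel k
    C : (a : Fin k) → PreLab R a → Label
open ADF public

ExactADF : ∀ {k} → ADF k → Labelling k → Set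
ExactADF G λ' = ∀ a → C G a (restrict (R G) a λ') ≡ λ' a

record Nuance : Set where
  field
    n₁ n₂ m₁ m₂ : ℕ
    n₁≤n₂ : n₁ ≤ n₂
    m₁≤m₂ : m₁ ≤ m₂
open Nuance public

record MMA (k : ℕ) : Set where
  field
    Rm : Rel k
    fQ : Fin k → Nuance
open MMA public

Designates : ∀ {k} → MMA k → Labelling k → Fin k → Label → Set
Designates F λ' a l = go l
  where
    q = fQ F a
    o = oPre (Rm F) a (restrict (Rm F) a λ')
    i = iPre (Rm F) a (restrict (Rm F) a λ')
    may-a   = n₁ q ≤ o
    must-a  = n₂ q ≤ o
    mays-a  = n₁ q ≤ o × o < n₂ q
    not-a   = o < n₁ q
    may-r   = m₁ q ≤ i
    must-r  = m₂ q ≤ i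
    mays-r  = m₁ q ≤ i × i < m₂ q
    not-r   = i < m₁ q
    go : Label → Set
    go lin    = may-a × ¬ must-r
    go lout   = may-r × ¬ must-a
    go lundec = (must-a × must-r) ⊎ mays-a ⊎ mays-r ⊎ (not-a × not-r)

ExactMMA : ∀ {k} → MMA k → Labelling k → Set
ExactMMA F λ' = ∀ a → Designates F λ' a (λ' a)

ExactOne : ∀ {k} → MMA k → Labelling k → Set
ExactOne F λ' = ExactMMA F λ' ×
  (∀ a l l' → Designates F λ' a l → Designates F λ' a l' → l ≡ l')

_∈₂_ : Label → Label × Label → Set
l ∈₂ (x , y) = (l ≡ x) ⊎ (l ≡ y)

AbstractsAt : ∀ {k} (G : ADF k) → Nuance → Fin k → Set
AbstractsAt G q a =
  (n₂ q ≤ suc (preSize (R G) a)) × (m₂ q ≤ suc (preSize (R G) a)) ×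
  (∀ (μ : PreLab (R G) a) →
    let o = oPre (R G) a μ
        i = iPre (R G) a μ
        c = C G a μ
    in (o < n₁ q → i < m₁ q → c ≡ lundec)
     × (n₁ q ≤ o → o < n₂ q → i < m₁ q → c ∈₂ (lin , lundec))
     × (n₂ q ≤ o → i < m₁ q → c ≡ lin)
     × (o < n₁ q → m₁ q ≤ i → i < m₂ q → c ∈₂ (lout , lundec))
     -- n₁ ≤ o < n₂, m₁ ≤ i < m₂ : arbitrary (no constraint)
     × (n₂ q ≤ o → m₁ q ≤ i → i < m₂ q → c ∈₂ (lin , lundec))
     × (o < n₁ q → m₂ q ≤ i → c ≡ lout)
     × (n₁ q ≤ o → o < n₂ q → m₂ q ≤ i → c ∈₂ (lout , lundec))
     × (n₂ q ≤ o → m₂ q ≤ i → c ≡ lundec))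

InΔ : ∀ {k} → ADF k → MMA k → Set
InΔ G F = (∀ a b → Rm F a b ≡ R G a b) × (∀ a → AbstractsAt G (fQ F a) a)

_⊴_ : Nuance → Nuance → Set
q ⊴ q' = (n₁ q' ≤ n₁ q) × (n₂ q ≤ n₂ q') × (m₁ q' ≤ m₁ q) × (m₂ q ≤ m₂ q')

_⊑_ : ∀ {k} → MMA k → MMA k → Set
F ⊑ F' = (∀ a b → Rm F a b ≡ Rm F' a b) × (∀ a → fQ F a ⊴ fQ F' a)

_⊏_ : ∀ {k} → MMA k → MMA k → Set
F' ⊏ F = (F' ⊑ F) × ¬ (F ⊑ F')

-- Given a labelling λ that is exact for F and designates a single label at
-- every argument, λ is exact for G: at each argument a, every label that the
-- abstraction conditions allow for C_a(λ) is designated by λ in F, and so is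
-- λ(a); by uniqueness the two coincide.
module Submission where

open import Defs
open import Data.Nat using (ℕ; zero; suc; _≤_; _<_; _≤?_)
open import Data.Nat.Properties using (≤-trans; ≰⇒>; <⇒≱)
open import Data.Bool using (Bool; true; false)
open import Data.Fin using (Fin; zero; suc)
open import Data.Product using (Σ; ∃; _×_; _,_; proj₂)
open import Data.Sum using (_⊎_; inj₁; inj₂)
open import Relation.Nullary using (¬_; yes; no)
open import Relation.Binary.PropositionalEquality
  using (_≡_; refl; sym; cong; subst₂)

count-cong : ∀ {k} {p q : Fin k → Bool} → (∀ i → p i ≡ q i) → count p ≡ count q
count-cong {zero}          e = refl
count-cong {suc k} {p} {q} e with p zero | q zero | e zero
... | true  | .true  | refl = cong suc (count-cong (λ i → e (suc i)))
... | false | .false | refl = count-cong (λ i → e (suc i))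

count₁-injective : ∀ {x y : Bool} → count {1} (λ _ → x) ≡ count {1} (λ _ → y) → x ≡ y
count₁-injective {true}  {true}  _ = refl
count₁-injective {false} {false} _ = refl
count₁-injective {true}  {false} ()
count₁-injective {false} {true}  ()

-- Defs keeps the per-attacker test inside oPre/iPre private; evaluating oPre
-- (iPre) on a one-argument framework exposes it, and count on one argument is
-- injective, so agreement of the attack column transfers attacker by attacker.
oPre-cong : ∀ {k} (R R′ : Rel k) (a : Fin k) (λ′ : Labelling k) →
  (∀ b → R b a ≡ R′ b a) → oPre R a (restrict R a λ′) ≡ oPre R′ a (restrict R′ a λ′)
oPre-cong R R′ a λ′ e = count-cong λ b →
  count₁-injective (cong (λ r → oPre {1} (λ _ _ → r) zero (λ _ _ → λ′ b)) (e b))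

iPre-cong : ∀ {k} (R R′ : Rel k) (a : Fin k) (λ′ : Labelling k) →
  (∀ b → R b a ≡ R′ b a) → iPre R a (restrict R a λ′) ≡ iPre R′ a (restrict R′ a λ′)
iPre-cong R R′ a λ′ e = count-cong λ b →
  count₁-injective (cong (λ r → iPre {1} (λ _ _ → r) zero (λ _ _ → λ′ b)) (e b))

-- Designation and the abstraction conditions depend on λ only through the
-- numbers o and i of out- and in-labelled attackers.

Designated : Nuance → ℕ → ℕ → Label → Set
Designated q o i lin    = n₁ q ≤ o × ¬ (m₂ q ≤ i)
Designated q o i lout   = m₁ q ≤ i × ¬ (n₂ q ≤ o)
Designated q o i lundec = (n₂ q ≤ o × m₂ q ≤ i) ⊎ (n₁ q ≤ o × o < n₂ q)
                        ⊎ (m₁ q ≤ i × i < m₂ q) ⊎ (o < n₁ q × i < m₁ q)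

Abstracts : Nuance → ℕ → ℕ → Label → Set
Abstracts q o i c =
    (o < n₁ q → i < m₁ q → c ≡ lundec)
  × (n₁ q ≤ o → o < n₂ q → i < m₁ q → c ∈₂ (lin , lundec))
  × (n₂ q ≤ o → i < m₁ q → c ≡ lin)
  × (o < n₁ q → m₁ q ≤ i → i < m₂ q → c ∈₂ (lout , lundec))
  × (n₂ q ≤ o → m₁ q ≤ i → i < m₂ q → c ∈₂ (lin , lundec))
  × (o < n₁ q → m₂ q ≤ i → c ≡ lout)
  × (n₁ q ≤ o → o < n₂ q → m₂ q ≤ i → c ∈₂ (lout , lundec))
  × (n₂ q ≤ o → m₂ q ≤ i → c ≡ lundec)

data Band (x y o : ℕ) : Set where
  below  : o < x → Band x y o
  within : x ≤ o → o < y → Band x y o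
  above  : y ≤ o → Band x y o

band : ∀ {x y} → x ≤ y → ∀ o → Band x y o
band {x} {y} x≤y o with x ≤? o | y ≤? o
... | no  o≱x | _       = below (≰⇒> o≱x)
... | yes x≤o | no  o≱y = within x≤o (≰⇒> o≱y)
... | yes _   | yes y≤o = above y≤o

∈₂-elim : ∀ {P : Label → Set} {c x y} → P x → P y → c ∈₂ (x , y) → P c
∈₂-elim px _  (inj₁ refl) = px
∈₂-elim _  py (inj₂ refl) = py

module _ (q : Nuance) (o i : ℕ) where

  all-designated-in-middle : n₁ q ≤ o → o < n₂ q → m₁ q ≤ i → i < m₂ q →
    ∀ c → Designated q o i c
  all-designated-in-middle n₁≤o o<n₂ m₁≤i i<m₂ lin    = n₁≤o , <⇒≱ i<m₂
  all-designated-in-middle n₁≤o o<n₂ m₁≤i i<m₂ lout   = m₁≤i , <⇒≱ o<n₂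
  all-designated-in-middle n₁≤o o<n₂ m₁≤i i<m₂ lundec = inj₂ (inj₁ (n₁≤o , o<n₂))

  abstracted-label-is-designated : ∀ c → Abstracts q o i c → Designated q o i c
  abstracted-label-is-designated c (c₁ , c₂ , c₃ , c₄ , c₅ , c₆ , c₇ , c₈)
    with band (n₁≤n₂ q) o | band (m₁≤m₂ q) i
  ... | below o<n₁ | below i<m₁ rewrite c₁ o<n₁ i<m₁ =
      inj₂ (inj₂ (inj₂ (o<n₁ , i<m₁)))
  ... | below o<n₁ | within m₁≤i i<m₂ = ∈₂-elim {Designated q o i}
      (m₁≤i , <⇒≱ (≤-trans o<n₁ (n₁≤n₂ q)))
      (inj₂ (inj₂ (inj₁ (m₁≤i , i<m₂))))
      (c₄ o<n₁ m₁≤i i<m₂)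
  ... | below o<n₁ | above m₂≤i rewrite c₆ o<n₁ m₂≤i =
      ≤-trans (m₁≤m₂ q) m₂≤i , <⇒≱ (≤-trans o<n₁ (n₁≤n₂ q))
  ... | within n₁≤o o<n₂ | below i<m₁ = ∈₂-elim {Designated q o i}
      (n₁≤o , <⇒≱ (≤-trans i<m₁ (m₁≤m₂ q)))
      (inj₂ (inj₁ (n₁≤o , o<n₂)))
      (c₂ n₁≤o o<n₂ i<m₁)
  ... | within n₁≤o o<n₂ | within m₁≤i i<m₂ =
      all-designated-in-middle n₁≤o o<n₂ m₁≤i i<m₂ c
  ... | within n₁≤o o<n₂ | above m₂≤i = ∈₂-elim {Designated q o i}
      (≤-trans (m₁≤m₂ q) m₂≤i , <⇒≱ o<n₂)
      (inj₂ (inj₁ (n₁≤o , o<n₂)))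
      (c₇ n₁≤o o<n₂ m₂≤i)
  ... | above n₂≤o | below i<m₁ rewrite c₃ n₂≤o i<m₁ =
      ≤-trans (n₁≤n₂ q) n₂≤o , <⇒≱ (≤-trans i<m₁ (m₁≤m₂ q))
  ... | above n₂≤o | within m₁≤i i<m₂ = ∈₂-elim {Designated q o i}
      (≤-trans (n₁≤n₂ q) n₂≤o , <⇒≱ i<m₂)
      (inj₂ (inj₂ (inj₁ (m₁≤i , i<m₂))))
      (c₅ n₂≤o m₁≤i i<m₂)
  ... | above n₂≤o | above m₂≤i rewrite c₈ n₂≤o m₂≤i = inj₁ (n₂≤o , m₂≤i)

#out #in : ∀ {k} → MMA k → Labelling k → Fin k → ℕ
#out F λ′ a = oPre (Rm F) a (restrict (Rm F) a λ′)
#in  F λ′ a = iPre (Rm F) a (restrict (Rm F) a λ′)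

designated⇒designates : ∀ {k} (F : MMA k) (λ′ : Labelling k) (a : Fin k) (l : Label) →
  Designated (fQ F a) (#out F λ′ a) (#in F λ′ a) l → Designates F λ′ a l
designated⇒designates F λ′ a lin    d = d
designated⇒designates F λ′ a lout   d = d
designated⇒designates F λ′ a lundec d = d

adf-label-abstracted : ∀ {k} (G : ADF k) (F : MMA k) → InΔ G F →
  ∀ λ′ a → Abstracts (fQ F a) (#out F λ′ a) (#in F λ′ a) (C G a (restrict (R G) a λ′))
adf-label-abstracted G F (sameR , abstracts) λ′ a =
  subst₂ (λ o i → Abstracts (fQ F a) o i (C G a (restrict (R G) a λ′)))
    (oPre-cong (R G) (Rm F) a λ′ column)
    (iPre-cong (R G) (Rm F) a λ′ column)
    (proj₂ (proj₂ (abstracts a)) (restrict (R G) a λ′))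
  where
  column : ∀ b → R G b a ≡ Rm F b a
  column b = sym (sameR b a)

mainTheorem8 : ∀ {k : ℕ} (G : ADF k) (F : MMA k) → InΔ G F →
    ¬ (Σ (MMA k) λ F' → InΔ G F' × (F' ⊏ F)) →
    (∃ λ λ' → ExactOne F λ') →
    ∃ λ λ' → ExactADF G λ'
mainTheorem8 G F F∈ΔG _ (λ′ , exact , unique) = λ′ , λ a →
  unique a _ (λ′ a)
    (designated⇒designates F λ′ a _
      (abstracted-label-is-designated (fQ F a) _ _ _ (adf-label-abstracted G F F∈ΔG λ′ a)))
    (exact a)
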